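{- For every signed graph $(G,\sigma)$, $\chi\big(\hat{G}^{[\sharp -2]}_{\mathrm{strong}}\big)\le \mathrm{col}_2(G)\cdot 2^{\mathrm{col}_2(G)-1}$.
   Context: A signed graph $(G,\sigma)$ is a finite simple graph $G$ with $\sigma:E(G)\to\{+,-\}$; the sign of a path is the product of its edge signs. The strong exact-distance $-2$ graph $\hat{G}^{[\sharp -2]}_{\mathrm{strong}}$ is the graph on $V(G)$ in which $xy$ is an edge iff $d_G(x,y)=2$ and some $xy$-path of length $2$ is negative. For a total ordering $L$ of $V(G)$, a vertex $x$ is strongly $r$-reachable from $y$ if there is an $xy$-path $P$ of length at most $r$ with $x\le_L z$ for all $z\in V(P)$ and $y\le_L z$ for all $z\in V(P)\setminus\{x\}$; $\mathrm{Reach}_r[G,L,y]$ is the set of such $x$ (including $y$). $\mathrm{col}_r(G)=\min_L\max_v|\mathrm{Reach}_r[G,L,v]|$. -}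

module Defs where

open import Data.Nat using (ℕ; zero; suc; _+_; _*_; _∸_; _^_) renaming (_≤_ to _≤ℕ_)
open import Data.Fin using (Fin; zero; suc; fromℕ; inject₁) renaming (_≤_ to _≤F_)
open import Data.Bool using (Bool; true; false; _xor_)
open import Data.Product using (Σ; ∃; ∃-syntax; _×_; _,_)
open import Data.Sum using (_⊎_)
open import Relation.Binary.PropositionalEquality using (_≡_; _≢_)
open import Function.Definitions using (Injective)
open import Function.Bundles using (_⇔_)

-- A signed (finite simple) graph on vertex set Fin n.
-- adj : adjacency (symmetric, irreflexive => simple graph).
-- neg x y ≡ true means the edge xy has sign − (only relevant on edges).
record SignedGraph (n : ℕ) : Set where
  field
    adj        : Fin n → Fin n → Bool
    adj-sym    : ∀ x y → adj x y ≡ adj y x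
    adj-irrefl : ∀ x → adj x x ≡ false
    neg        : Fin n → Fin n → Bool
    neg-sym    : ∀ x y → neg x y ≡ neg y x

open SignedGraph public

module _ {n : ℕ} (G : SignedGraph n) where

  Adj : Fin n → Fin n → Set
  Adj x y = adj G x y ≡ true

  record Path (x y : Fin n) (k : ℕ) : Set where
    field
      vtx      : Fin (suc k) → Fin n
      start    : vtx zero ≡ x
      end      : vtx (fromℕ k) ≡ y
      step     : ∀ (i : Fin k) → Adj (vtx (inject₁ i)) (vtx (suc i))
      distinct : Injective _≡_ _≡_ vtx

  -- Parity of the number of negative edges along the vertex sequence
  -- (true = sign of the path is −, i.e. the product of edge signs is −).
  negParity : (k : ℕ) → (Fin (suc k) → Fin n) → Bool
  negParity zero    p = false
  negParity (suc k) p = neg G (p zero) (p (suc zero)) xor negParity k (λ i → p (suc i))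

  NegativePath : ∀ {x y k} → Path x y k → Set
  NegativePath {k = k} P = negParity k (Path.vtx P) ≡ true

  Dist : Fin n → Fin n → ℕ → Set
  Dist x y d = Path x y d × (∀ k → Path x y k → d ≤ℕ k)

  StrongExact-2 : Fin n → Fin n → Set
  StrongExact-2 x y = Dist x y 2 × Σ (Path x y 2) NegativePath

LinOrder : ℕ → Set
LinOrder n = Σ (Fin n → Fin n) (Injective _≡_ _≡_)

_≤[_]_ : ∀ {n} → Fin n → LinOrder n → Fin n → Set
x ≤[ (rank , _) ] y = rank x ≤F rank y

HasCard : ∀ {n} → (Fin n → Set) → ℕ → Set
HasCard {n} P k = Σ (Fin k → Fin n) λ f → Injective _≡_ _≡_ f × (∀ x → P x ⇔ (∃[ i ] f i ≡ x))

module _ {n : ℕ} (G : SignedGraph n) (L : LinOrder n) (r : ℕ) where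

  SReach : Fin n → Fin n → Set
  SReach x y = ∃[ k ] (k ≤ℕ r × Σ (Path G x y k) λ P →
                 (∀ i → x ≤[ L ] Path.vtx P i)
               × (∀ i → Path.vtx P i ≢ x → y ≤[ L ] Path.vtx P i))

  ReachSize : Fin n → ℕ → Set
  ReachSize y k = HasCard (λ x → SReach x y) k

-- col_r(G) = m, i.e. m = min_L max_v |Reach_r[G,L,v]|
-- (max over the empty vertex set taken to be 0).
IsCol : ∀ {n} → SignedGraph n → ℕ → ℕ → Set
IsCol {n} G r m =
    (∃[ L ] ∀ v → ∃[ k ] (k ≤ℕ m × ReachSize G L r v k))
  × (∀ (L : LinOrder n) → m ≡ 0 ⊎ (∃[ v ] ∃[ k ] (m ≤ℕ k × ReachSize G L r v k)))

Colourable : ∀ {n} → (Fin n → Fin n → Set) → ℕ → Set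
Colourable {n} H k = Σ (Fin n → Fin k) λ c → ∀ x y → H x y → c x ≢ c y

-- Fix an ordering in which every |Reach₂[v]| ≤ m and colour greedily along it: first
-- c(v) ∈ [m] avoiding the colours of Reach₂[v] ∖ {v}, so that the smaller neighbours of any
-- vertex get distinct colours; then a sign vector f(v) : [m] → ± (see Consistent).  Colour v by
-- c(v) together with f(v) off c(v).  Suppose x – z – y is a negative wedge, x before y, and x, y
-- get the same colour.  If z comes after y, then x ∈ Reach₂[y].  If z lies between x and y, the
-- walk recorded by f(y) at c(z) ends in x, so the wedge would be positive.  If z comes first, the
-- walks recorded by f(x) and f(y) at c(z) agree after their first edges, so xz and yz would have
-- the same sign.
module Submission where

open import Defs
open import Data.Nat as ℕ using (ℕ; zero; suc; _*_; _∸_; _^_; _<_; _≤_; z≤n; s≤s)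
open import Data.Nat.Properties using (≤-refl; <⇒≤; <-trans; <-irrefl; <⇒≱; <-cmp; ≤-<-trans; m<1+n⇒m<n∨m≡n)
open import Data.Fin as Fin using (Fin; zero; suc; toℕ; punchIn; punchOut; combine; funToFin; finToFun)
open import Data.Fin.Properties using (toℕ-injective; toℕ<n; any?; all?; ¬∀⟶∃¬; injective⇒≤; punchIn-punchOut; combine-injective; finToFun-funToFin; 2↔Bool)
open import Data.Bool as Bool using (Bool; true; false; _xor_)
open import Data.Bool.Properties using (xor-identityʳ; xor-same; xor-comm; xor-assoc; xor-∧-commutativeRing)
open import Data.Product using (Σ; ∃; ∃-syntax; _×_; _,_; proj₁; proj₂; map₂)
open import Data.Sum using (inj₁; inj₂; [_,_]; _⊎_)
open import Data.Empty using (⊥; ⊥-elim)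
open import Data.Vec.Functional using (updateAt)
open import Data.Vec.Functional.Properties using (updateAt-updates; updateAt-minimal)
open import Relation.Nullary using (¬_; Dec; yes; no; contradiction)
open import Relation.Nullary.Decidable using (_×-dec_; ¬?; decidable-stable)
open import Relation.Binary using (tri<; tri≈; tri>)
open import Relation.Binary.PropositionalEquality using (_≡_; _≢_; refl; sym; trans; cong; cong₂; cong-app; subst; subst₂; module ≡-Reasoning)
open import Function using (_∘_; const)
open import Function.Definitions using (Injective)
open import Function.Bundles using (Equivalence; Inverse)
open import Algebra.Bundles using (CommutativeRing)
open import Algebra.Properties.Group (CommutativeRing.+-group xor-∧-commutativeRing)
  using (∙-cancelʳ; identityˡ-unique)

missing-value : ∀ {k m} (h : Fin k → Fin m) → k < m → ∃ λ j → ∀ i → h i ≢ j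
missing-value {k} h k<m with any? (λ j → all? (λ i → ¬? (h i Fin.≟ j)))
... | yes found = found
... | no none = contradiction (injective⇒≤ preimage-injective) (<⇒≱ k<m)
  where
    preimage : ∀ j → ∃ λ i → h i ≡ j
    preimage j = map₂ (decidable-stable (h _ Fin.≟ j))
                      (¬∀⟶∃¬ k _ (λ i → ¬? (h i Fin.≟ j)) (λ miss → none (j , miss)))

    preimage-injective : Injective _≡_ _≡_ (proj₁ ∘ preimage)
    preimage-injective {j} {j′} eq =
      trans (sym (proj₂ (preimage j))) (trans (cong h eq) (proj₂ (preimage j′)))

missing-value-except : ∀ {k m} (h : Fin k → Fin m) (i₀ : Fin k) → k ≤ m →
                       ∃ λ j → ∀ i → i₀ ≢ i → h i ≢ j
missing-value-except {suc k} h i₀ k<m with missing-value (h ∘ punchIn i₀) k<m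
... | j , missed = j , λ i i₀≢i → subst (λ i → h i ≢ j) (punchIn-punchOut i₀≢i) (missed (punchOut i₀≢i))

encode : ∀ {m} → Fin (suc m) → (Fin (suc m) → Bool) → Fin (suc m * 2 ^ m)
encode a g = combine a (funToFin (Inverse.from 2↔Bool ∘ g ∘ punchIn a))

encode-injective : ∀ {m} {a b : Fin (suc m)} {g h : Fin (suc m) → Bool} →
                   encode a g ≡ encode b h → a ≡ b × (∀ j → a ≢ j → g j ≡ h j)
encode-injective {a = a} {b} {g} {h} eq with combine-injective a _ b _ eq
... | refl , codes-equal = refl , λ j a≢j →
  subst (λ j → g j ≡ h j) (punchIn-punchOut a≢j) (signs-equal (punchOut a≢j))
  where
    open Inverse 2↔Bool using (to; from; strictlyInverseˡ)

    signs-equal : ∀ i → g (punchIn a i) ≡ h (punchIn a i)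
    signs-equal i = begin
      g (punchIn a i)                                   ≡⟨ strictlyInverseˡ _ ⟨
      to (from (g (punchIn a i)))                       ≡⟨ cong to (finToFun-funToFin (from ∘ g ∘ punchIn a) i) ⟨
      to (finToFun (funToFin (from ∘ g ∘ punchIn a)) i) ≡⟨ cong (λ code → to (finToFun code i)) codes-equal ⟩
      to (finToFun (funToFin (from ∘ h ∘ punchIn a)) i) ≡⟨ cong to (finToFun-funToFin (from ∘ h ∘ punchIn a) i) ⟩
      to (from (h (punchIn a i)))                       ≡⟨ strictlyInverseˡ _ ⟩
      h (punchIn a i)                                   ∎
      where open ≡-Reasoning

colourable-⊆ : ∀ {n} {H H′ : Fin n → Fin n → Set} {k} →
               (∀ {x y} → H x y → H′ x y) → Colourable H′ k → Colourable H k
colourable-⊆ H⊆H′ (c , proper) = c , λ x y → proper x y ∘ H⊆H′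

module _ {n : ℕ} (G : SignedGraph n) where

  adj⇒≢ : ∀ {x y} → Adj G x y → x ≢ y
  adj⇒≢ {x} xy refl with trans (sym xy) (adj-irrefl G x)
  ... | ()

  adj-symmetric : ∀ {x y} → Adj G x y → Adj G y x
  adj-symmetric {x} {y} xy = trans (adj-sym G y x) xy

  trivialPath : ∀ x → Path G x x 0
  trivialPath x = record { vtx = const x ; start = refl ; end = refl ; step = λ () ; distinct = distinct }
    where
      distinct : ∀ {i j : Fin 1} → x ≡ x → i ≡ j
      distinct {zero} {zero} _ = refl

  edgePath : ∀ {x y} → Adj G x y → Path G x y 1
  edgePath {x} {y} xy = record { vtx = vtx ; start = refl ; end = refl ; step = step ; distinct = distinct }
    where
      vtx : Fin 2 → Fin n
      vtx zero    = x
      vtx (suc _) = y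

      step : ∀ i → Adj G (vtx (Fin.inject₁ i)) (vtx (suc i))
      step zero = xy

      distinct : Injective _≡_ _≡_ vtx
      distinct {zero}     {zero}     _  = refl
      distinct {zero}     {suc zero} eq = ⊥-elim (adj⇒≢ xy eq)
      distinct {suc zero} {zero}     eq = ⊥-elim (adj⇒≢ xy (sym eq))
      distinct {suc zero} {suc zero} _  = refl

  wedgePath : ∀ {x z y} → Adj G x z → Adj G z y → x ≢ y → Path G x y 2
  wedgePath {x} {z} {y} xz zy x≢y =
    record { vtx = vtx ; start = refl ; end = refl ; step = step ; distinct = distinct }
    where
      vtx : Fin 3 → Fin n
      vtx zero          = x
      vtx (suc zero)    = z
      vtx (suc (suc _)) = y

      step : ∀ i → Adj G (vtx (Fin.inject₁ i)) (vtx (suc i))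
      step zero       = xz
      step (suc zero) = zy

      distinct : Injective _≡_ _≡_ vtx
      distinct {zero}           {zero}           _  = refl
      distinct {zero}           {suc zero}       eq = ⊥-elim (adj⇒≢ xz eq)
      distinct {zero}           {suc (suc zero)} eq = ⊥-elim (x≢y eq)
      distinct {suc zero}       {zero}           eq = ⊥-elim (adj⇒≢ xz (sym eq))
      distinct {suc zero}       {suc zero}       _  = refl
      distinct {suc zero}       {suc (suc zero)} eq = ⊥-elim (adj⇒≢ zy eq)
      distinct {suc (suc zero)} {zero}           eq = ⊥-elim (x≢y (sym eq))
      distinct {suc (suc zero)} {suc zero}       eq = ⊥-elim (adj⇒≢ zy (sym eq))
      distinct {suc (suc zero)} {suc (suc zero)} _  = refl

  NegativeWedge : Fin n → Fin n → Fin n → Set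
  NegativeWedge x z y = Adj G x z × Adj G z y × neg G x z xor neg G z y ≡ true

  negativePath⇒negativeWedge : ∀ {x y} → Σ (Path G x y 2) (NegativePath G) → ∃ λ z → NegativeWedge x z y
  negativePath⇒negativeWedge (record { vtx = p ; start = refl ; end = refl ; step = step } , negative) =
    p (suc zero) , step zero , step (suc zero) ,
    trans (cong (neg G (p zero) (p (suc zero)) xor_) (sym (xor-identityʳ _))) negative

  negativeWedge-sym : ∀ {x z y} → NegativeWedge x z y → NegativeWedge y z x
  negativeWedge-sym {x} {z} {y} (xz , zy , negative) =
    adj-symmetric zy , adj-symmetric xz , (begin
      neg G y z xor neg G z x ≡⟨ cong₂ _xor_ (neg-sym G y z) (neg-sym G z x) ⟩
      neg G z y xor neg G x z ≡⟨ xor-comm (neg G z y) (neg G x z) ⟩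
      neg G x z xor neg G z y ≡⟨ negative ⟩
      true                    ∎)
    where open ≡-Reasoning

  negativeWedge-irrefl : ∀ {x z} → ¬ NegativeWedge x z x
  negativeWedge-irrefl {x} {z} (_ , _ , negative) with
    trans (sym negative) (trans (cong (neg G x z xor_) (neg-sym G z x)) (xor-same (neg G x z)))
  ... | ()

  module Ordered (rank : Fin n → Fin n) (rank-injective : Injective _≡_ _≡_ rank) where

    r : Fin n → ℕ
    r = toℕ ∘ rank

    _≺_ : Fin n → Fin n → Set
    u ≺ v = r u < r v

    r-injective : ∀ {u v} → r u ≡ r v → u ≡ v
    r-injective = rank-injective ∘ toℕ-injective

    ≺⇒≢ : ∀ {u v} → u ≺ v → u ≢ v
    ≺⇒≢ u≺v refl = <-irrefl refl u≺v

    Reach : Fin n → Fin n → Set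
    Reach = SReach G (rank , rank-injective) 2

    ReachBounded : ℕ → Set
    ReachBounded m = ∀ v → ∃[ k ] (k ≤ m × ReachSize G (rank , rank-injective) 2 v k)

    reach-refl : ∀ v → Reach v v
    reach-refl v = 0 , z≤n , trivialPath v , (λ _ → ≤-refl) , (λ _ v≢v → ⊥-elim (v≢v refl))

    reach-≤ : ∀ {u v} → Reach u v → r u ≤ r v
    reach-≤ {u} (k , _ , P , u-least , _) = subst (λ w → r u ≤ r w) (Path.end P) (u-least (Fin.fromℕ k))

    reach-edge : ∀ {v z} → Adj G v z → z ≺ v → Reach z v
    reach-edge {v} {z} vz z≺v = 1 , s≤s z≤n , edgePath (adj-symmetric vz) , z-least , v-least
      where
        z-least : ∀ i → rank z Fin.≤ rank (Path.vtx (edgePath (adj-symmetric vz)) i)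
        z-least zero       = ≤-refl
        z-least (suc zero) = <⇒≤ z≺v

        v-least : ∀ i → Path.vtx (edgePath (adj-symmetric vz)) i ≢ z →
                  rank v Fin.≤ rank (Path.vtx (edgePath (adj-symmetric vz)) i)
        v-least zero       z≢z = ⊥-elim (z≢z refl)
        v-least (suc zero) _   = ≤-refl

    reach-wedge : ∀ {u w v} → Adj G u w → Adj G w v → u ≺ v → v ≺ w → Reach u v
    reach-wedge {u} {w} {v} uw wv u≺v v≺w = 2 , ≤-refl , P , u-least , v-least
      where
        P : Path G u v 2
        P = wedgePath uw wv (≺⇒≢ u≺v)

        u-least : ∀ i → rank u Fin.≤ rank (Path.vtx P i)
        u-least zero             = ≤-refl
        u-least (suc zero)       = <⇒≤ (<-trans u≺v v≺w)
        u-least (suc (suc zero)) = <⇒≤ u≺v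

        v-least : ∀ i → Path.vtx P i ≢ u → rank v Fin.≤ rank (Path.vtx P i)
        v-least zero             u≢u = ⊥-elim (u≢u refl)
        v-least (suc zero)       _   = <⇒≤ v≺w
        v-least (suc (suc zero)) _   = ≤-refl

    reachBounded-0⇒empty : ReachBounded 0 → ¬ Fin n
    reachBounded-0⇒empty bounded v with bounded v
    ... | zero , _ , _ , _ , enumerates with Equivalence.to (enumerates v) (reach-refl v)
    ... | () , _

    module _ {A : Set} (Good : (Fin n → A) → Fin n → Set)
             (Good-local : ∀ {g g′} v → (∀ u → r u ≤ r v → g u ≡ g′ u) → Good g v → Good g′ v)
             (Good-extend : ∀ g w → ∃ λ a → Good (updateAt g w (const a)) w) where

      greedy-below : (Fin n → A) → ∀ p → ∃ λ g → ∀ v → r v < p → Good g v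
      greedy-below g₀ zero = g₀ , λ _ ()
      greedy-below g₀ (suc p) with greedy-below g₀ p | any? (λ w → r w ℕ.≟ p)
      ... | g , good | no ∄w = g , λ v v<1+p →
        [ good v , (λ rv≡p → ⊥-elim (∄w (v , rv≡p))) ] (m<1+n⇒m<n∨m≡n v<1+p)
      ... | g , good | yes (w , refl) = updateAt g w (const a) , good′
        where
          a : A
          a = proj₁ (Good-extend g w)

          good′ : ∀ v → r v < suc (r w) → Good (updateAt g w (const a)) v
          good′ v v<1+w with m<1+n⇒m<n∨m≡n v<1+w
          ... | inj₁ v≺w = Good-local v (λ u u≤v → sym (updateAt-minimal u w g (≺⇒≢ (≤-<-trans u≤v v≺w))))
                                        (good v v≺w)
          ... | inj₂ rv≡rw with r-injective rv≡rw
          ... | refl = proj₂ (Good-extend g w)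

      greedy : (Fin n → A) → ∃ λ g → ∀ v → Good g v
      greedy g₀ with greedy-below g₀ n
      ... | g , good = g , λ v → good v (toℕ<n (rank v))

    ReachProperAt : ∀ {m} → (Fin n → Fin m) → Fin n → Set
    ReachProperAt c v = ∀ u → Reach u v → u ≢ v → c u ≢ c v

    reachProperAt-local : ∀ {m} {c c′ : Fin n → Fin m} v → (∀ u → r u ≤ r v → c u ≡ c′ u) →
                          ReachProperAt c v → ReachProperAt c′ v
    reachProperAt-local v agree proper u uv u≢v =
      subst₂ _≢_ (agree u (reach-≤ uv)) (agree v ≤-refl) (proper u uv u≢v)

    module Signs {m} (c : Fin n → Fin m) (c-proper : ∀ v → ReachProperAt c v) where

      LowerNbr : Fin n → Fin n → Set
      LowerNbr z x = Adj G z x × x ≺ z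

      ColouredLowerNbr : Fin n → Fin m → Set
      ColouredLowerNbr z j = ∃ λ x → LowerNbr z x × c x ≡ j

      colouredLowerNbr? : ∀ z j → Dec (ColouredLowerNbr z j)
      colouredLowerNbr? z j = any? λ x → ((adj G z x Bool.≟ true) ×-dec (r x ℕ.<? r z)) ×-dec (c x Fin.≟ j)

      lowerNbr-colour-injective : ∀ {z a b} → LowerNbr z a → LowerNbr z b → c a ≡ c b → a ≡ b
      lowerNbr-colour-injective {z} {a} {b} (za , a≺z) (zb , b≺z) ca≡cb with <-cmp (r a) (r b)
      ... | tri< a≺b _ _ = ⊥-elim (c-proper b a (reach-wedge (adj-symmetric za) zb a≺b b≺z) (≺⇒≢ a≺b) ca≡cb)
      ... | tri≈ _ ra≡rb _ = r-injective ra≡rb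
      ... | tri> _ _ b≺a = ⊥-elim (c-proper a b (reach-wedge (adj-symmetric zb) za b≺a a≺z) (≺⇒≢ b≺a) (sym ca≡cb))

      -- f v (c z) is the sign of the walk from v through z to its smaller neighbour x of colour
      -- c v, continued by f x (c z); if there is no such x, the walk stops at z.
      Consistent : (Fin n → Fin m → Bool) → Fin n → Fin n → Set
      Consistent f v z =
          (∃ λ x → LowerNbr z x × c x ≡ c v × f v (c z) ≡ neg G v z xor (neg G z x xor f x (c z)))
        ⊎ (¬ ColouredLowerNbr z (c v) × f v (c z) ≡ neg G v z)

      ConsistentAt : (Fin n → Fin m → Bool) → Fin n → Set
      ConsistentAt f v = ∀ z → LowerNbr v z → Consistent f v z

      consistentAt-local : ∀ {f f′} v → (∀ u → r u ≤ r v → f u ≡ f′ u) → ConsistentAt f v → ConsistentAt f′ v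
      consistentAt-local {f} {f′} v agree consistent z (vz , z≺v) with consistent z (vz , z≺v)
      ... | inj₁ (x , (zx , x≺z) , cx≡cv , eq) =
        inj₁ (x , (zx , x≺z) , cx≡cv ,
              trans (sym (agree-at v ≤-refl))
                    (trans eq (cong (λ b → neg G v z xor (neg G z x xor b)) (agree-at x (<⇒≤ (<-trans x≺z z≺v))))))
        where
          agree-at : ∀ u → r u ≤ r v → f u (c z) ≡ f′ u (c z)
          agree-at u u≤v = cong-app (agree u u≤v) (c z)
      ... | inj₂ (∄x , eq) = inj₂ (∄x , trans (sym (cong-app (agree v ≤-refl) (c z))) eq)

      walkSign : (Fin n → Fin m → Bool) → (w z : Fin n) → Dec (ColouredLowerNbr z (c w)) → Bool
      walkSign f w z (yes (x , _)) = neg G w z xor (neg G z x xor f x (c z))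
      walkSign f w z (no _)        = neg G w z

      colourSign : (Fin n → Fin m → Bool) → (w : Fin n) → ∀ {j} → Dec (ColouredLowerNbr w j) → Bool
      colourSign f w (yes (z , _)) = walkSign f w z (colouredLowerNbr? z (c w))
      colourSign f w (no _)        = false

      newSigns : (Fin n → Fin m → Bool) → Fin n → Fin m → Bool
      newSigns f w j = colourSign f w (colouredLowerNbr? w j)

      newSigns-lowerNbr : ∀ f {w z} → LowerNbr w z →
                          newSigns f w (c z) ≡ walkSign f w z (colouredLowerNbr? z (c w))
      newSigns-lowerNbr f {w} {z} wz with colouredLowerNbr? w (c z)
      ... | yes (z′ , wz′ , cz′≡cz) =
        cong (λ z → walkSign f w z (colouredLowerNbr? z (c w))) (lowerNbr-colour-injective wz′ wz cz′≡cz)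
      ... | no ∄z = ⊥-elim (∄z (z , wz , refl))

      newSigns-consistent : ∀ f w → ConsistentAt (updateAt f w (const (newSigns f w))) w
      newSigns-consistent f w z wz =
        consistent-via (colouredLowerNbr? z (c w))
                       (trans (cong-app (updateAt-updates w f) (c z)) (newSigns-lowerNbr f wz))
        where
          f′ : Fin n → Fin m → Bool
          f′ = updateAt f w (const (newSigns f w))

          consistent-via : (d : Dec (ColouredLowerNbr z (c w))) → f′ w (c z) ≡ walkSign f w z d → Consistent f′ w z
          consistent-via (yes (x , (zx , x≺z) , cx≡cw)) eq =
            inj₁ (x , (zx , x≺z) , cx≡cw ,
                  trans eq (cong (λ b → neg G w z xor (neg G z x xor b))
                                 (sym (cong-app (updateAt-minimal x w f (≺⇒≢ (<-trans x≺z (proj₂ wz)))) (c z)))))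
          consistent-via (no ∄x) eq = inj₂ (∄x , eq)

      module _ (f : Fin n → Fin m → Bool) (f-consistent : ∀ v → ConsistentAt f v) where

        SameCode : Fin n → Fin n → Set
        SameCode x y = c x ≡ c y × (∀ j → c x ≢ j → f x j ≡ f y j)

        codes-differ-centre-last : ∀ {x z y} → NegativeWedge x z y → x ≺ y → y ≺ z → ¬ SameCode x y
        codes-differ-centre-last (xz , zy , _) x≺y y≺z (cx≡cy , _) =
          c-proper _ _ (reach-wedge xz zy x≺y y≺z) (≺⇒≢ x≺y) cx≡cy

        codes-differ-centre-between : ∀ {x z y} → NegativeWedge y z x → x ≺ z → z ≺ y → ¬ SameCode x y
        codes-differ-centre-between {x} {z} {y} (yz , zx , negative) x≺z z≺y (cx≡cy , agree) =
          conclude (f-consistent y z (yz , z≺y))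
          where
            shared : f x (c z) ≡ f y (c z)
            shared = agree (c z) λ cx≡cz → c-proper y z (reach-edge yz z≺y) (≺⇒≢ z≺y) (trans (sym cx≡cz) cx≡cy)

            walk-positive : f y (c z) ≡ neg G y z xor (neg G z x xor f x (c z)) → neg G y z xor neg G z x ≡ false
            walk-positive eq = identityˡ-unique _ (f x (c z)) (begin
              (neg G y z xor neg G z x) xor f x (c z) ≡⟨ xor-assoc (neg G y z) (neg G z x) (f x (c z)) ⟩
              neg G y z xor (neg G z x xor f x (c z)) ≡⟨ sym eq ⟩
              f y (c z)                                ≡⟨ sym shared ⟩
              f x (c z)                                ∎)
              where open ≡-Reasoning

            conclude : Consistent f y z → ⊥
            conclude (inj₁ (x′ , zx′ , cx′≡cy , eq))
              with lowerNbr-colour-injective zx′ (zx , x≺z) (trans cx′≡cy (sym cx≡cy))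
            ... | refl with trans (sym negative) (walk-positive eq)
            ... | ()
            conclude (inj₂ (∄x , _)) = ∄x (x , (zx , x≺z) , cx≡cy)

        codes-differ-centre-first : ∀ {x z y} → NegativeWedge x z y → z ≺ x → x ≺ y → ¬ SameCode x y
        codes-differ-centre-first {x} {z} {y} (xz , zy , negative) z≺x x≺y (cx≡cy , agree) =
          conclude (f-consistent x z (xz , z≺x)) (f-consistent y z (adj-symmetric zy , <-trans z≺x x≺y))
          where
            shared : f x (c z) ≡ f y (c z)
            shared = agree (c z) λ cx≡cz → c-proper x z (reach-edge xz z≺x) (≺⇒≢ z≺x) (sym cx≡cz)

            signs-differ : neg G x z ≢ neg G y z
            signs-differ eq with trans (sym negative) (trans (cong₂ _xor_ eq (neg-sym G z y)) (xor-same (neg G y z)))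
            ... | ()

            conclude : Consistent f x z → Consistent f y z → ⊥
            conclude (inj₁ (w , zw , cw≡cx , ex)) (inj₁ (w′ , zw′ , cw′≡cy , ey))
              with lowerNbr-colour-injective zw zw′ (trans cw≡cx (trans cx≡cy (sym cw′≡cy)))
            ... | refl = signs-differ (∙-cancelʳ _ _ _ (trans (sym ex) (trans shared ey)))
            conclude (inj₁ (w , zw , cw≡cx , _)) (inj₂ (∄w , _)) = ∄w (w , zw , trans cw≡cx cx≡cy)
            conclude (inj₂ (∄w , _)) (inj₁ (w , zw , cw≡cy , _)) = ∄w (w , zw , trans cw≡cy (sym cx≡cy))
            conclude (inj₂ (_ , ex)) (inj₂ (_ , ey)) = signs-differ (trans (sym ex) (trans shared ey))

        negativeWedge-codes-differ : ∀ {x z y} → NegativeWedge x z y → x ≺ y → ¬ SameCode x y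
        negativeWedge-codes-differ {x} {z} {y} wedge@(xz , zy , _) x≺y with <-cmp (r z) (r x)
        ... | tri< z≺x _ _ = codes-differ-centre-first wedge z≺x x≺y
        ... | tri≈ _ rz≡rx _ = ⊥-elim (adj⇒≢ xz (sym (r-injective rz≡rx)))
        ... | tri> _ _ x≺z with <-cmp (r z) (r y)
        ...   | tri< z≺y _ _ = codes-differ-centre-between (negativeWedge-sym wedge) x≺z z≺y
        ...   | tri≈ _ rz≡ry _ = ⊥-elim (adj⇒≢ zy (r-injective rz≡ry))
        ...   | tri> _ _ y≺z = codes-differ-centre-last wedge x≺y y≺z

      consistent-signs : ∃ λ f → ∀ v → ConsistentAt f v
      consistent-signs =
        greedy ConsistentAt consistentAt-local (λ f w → newSigns f w , newSigns-consistent f w) (const (const false))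

    module _ {m} (bounded : ReachBounded m) where

      free-colour : (c : Fin n → Fin m) → ∀ v → ∃ λ j → ∀ u → Reach u v → u ≢ v → c u ≢ j
      free-colour c v with bounded v
      ... | k , k≤m , e , _ , enumerates with Equivalence.to (enumerates v) (reach-refl v)
      ... | i₀ , ei₀≡v with missing-value-except (c ∘ e) i₀ k≤m
      ... | j , missed = j , λ u uv u≢v → proof u (Equivalence.to (enumerates u) uv) u≢v
        where
          proof : ∀ u → (∃ λ i → e i ≡ u) → u ≢ v → c u ≢ j
          proof u (i , refl) ei≢v = missed i (λ i₀≡i → ei≢v (trans (cong e (sym i₀≡i)) ei₀≡v))

      reachProper-colouring : Fin m → ∃ λ c → ∀ v → ReachProperAt c v
      reachProper-colouring j₀ = greedy ReachProperAt reachProperAt-local extend (const j₀)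
        where
          extend : ∀ c w → ∃ λ j → ReachProperAt (updateAt c w (const j)) w
          extend c w with free-colour c w
          ... | j , free = j , λ u uw u≢w →
            subst₂ _≢_ (sym (updateAt-minimal u w c u≢w)) (sym (updateAt-updates w c)) (free u uw u≢w)

    negativeWedges-colourable : ∀ {m} → ReachBounded (suc m) →
                                Colourable (λ x y → ∃ λ z → NegativeWedge x z y) (suc m * 2 ^ m)
    negativeWedges-colourable {m} bounded with reachProper-colouring bounded zero
    ... | c , c-proper with Signs.consistent-signs c c-proper
    ... | f , f-consistent = κ , proper
      where
        open Signs c c-proper using (negativeWedge-codes-differ)

        κ : Fin n → Fin (suc m * 2 ^ m)
        κ v = encode (c v) (f v)

        proper : ∀ x y → (∃ λ z → NegativeWedge x z y) → κ x ≢ κ y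
        proper x y (z , wedge) κx≡κy with <-cmp (r x) (r y)
        ... | tri< x≺y _ _ = negativeWedge-codes-differ f f-consistent wedge x≺y (encode-injective κx≡κy)
        ... | tri> _ _ y≺x =
          negativeWedge-codes-differ f f-consistent (negativeWedge-sym wedge) y≺x (encode-injective (sym κx≡κy))
        ... | tri≈ _ rx≡ry _ with r-injective rx≡ry
        ... | refl = negativeWedge-irrefl wedge

-- Only the ordering witnessing col₂(G) ≤ m is needed, not the minimality of m.
corollary4 : (n : ℕ) (G : SignedGraph n) (m : ℕ) → IsCol G 2 m →
    Colourable (StrongExact-2 G) (m * 2 ^ (m ∸ 1))
corollary4 n G zero (((rank , rank-injective) , bounded) , _) =
  (λ v → ⊥-elim (no-vertex v)) , λ x _ _ → ⊥-elim (no-vertex x)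
  where
    no-vertex : ¬ Fin n
    no-vertex = Ordered.reachBounded-0⇒empty G rank rank-injective bounded
corollary4 n G (suc m) (((rank , rank-injective) , bounded) , _) =
  colourable-⊆ (negativePath⇒negativeWedge G ∘ proj₂)
               (Ordered.negativeWedges-colourable G rank rank-injective bounded)
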